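{- Let $G$ be a finite simple graph and $f\colon V(G)\to\mathbb{N}$. If $G$ is weak$^*$ $f$-degenerate, then $G$ is $f$-AT. Consequently, the Alon–Tarsi number satisfies $AT(G)\le wd^*(G)$.
   Context: $\mathbb{N}=\{0,1,2,\dots\}$. Weak$^*$ degeneracy: for pairs $(G,f)$ with $f\colon V(G)\to\mathbb{N}$, define operations (1) $\mathsf{ReduceValue}_{x,s}(G,f)=(G,f')$, $f'$ equal to $f$ except $f'(x)=f(x)-s$ ($s$ a positive integer), legal if $f(x)>s$; (2) $\mathsf{EdgeDelete}_{(x,y)}(G,f)=(G-xy,f')$ for an edge $xy$, $f'$ equal to $f$ except $f'(x)=f(x)-f(y)$, legal if $f(x)>f(y)$; (3) $\mathsf{VertexDelete}_x(G,f)=(G-x,f')$ where $f'(v)=f(v)-1$ for neighbours $v$ of $x$ and $f'(v)=f(v)$ for other $v\ne x$, legal if $f(x)>0$. $G$ is weak$^*$ $f$-degenerate if some finite sequence of legal operations transforms $(G,f)$ into the empty graph (no vertices); $wd^*(G)$ is the least integer $d$ such that $G$ is weak$^*$ $d$-degenerate. $f$-AT: fix an ordering $<$ of $V(G)$ and let $P_G=\prod_{uv\in E(G),\,u<v}(x_u-x_v)$. $G$ is $f$-AT if there is $t\colon V(G)\to\mathbb{N}$ with $t(v)+1\le f(v)$ for all $v$ such that the coefficient of $\prod_v x_v^{t(v)}$ in $P_G$ is nonzero. $AT(G)$ is the least $k$ such that $G$ is $k$-AT. -}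

module Defs where

open import Data.Nat using (ℕ; zero; suc; _+_; _∸_; _<_; _≤_)
open import Data.Integer as ℤ using (ℤ)
open import Data.Bool using (Bool; true; false; _∧_; not; if_then_else_)
open import Data.Fin using (Fin; _<?_)
import Data.Fin.Properties as FinP
open import Data.Vec using (Vec; tabulate; zipWith; replicate)
import Data.Vec.Properties as VecP
open import Data.List using (List; []; _∷_; _++_; map; concatMap; foldr; filter)
open import Data.List.Base using (allFin)
open import Data.Product using (_×_; _,_; proj₁; proj₂; Σ; ∃)
open import Relation.Nullary using (¬_; does)
open import Relation.Binary.PropositionalEquality using (_≡_; _≢_)

record Graph (n : ℕ) : Set where
  field
    adj    : Fin n → Fin n → Bool
    sym    : ∀ u v → adj u v ≡ adj v u
    irrefl : ∀ v → adj v v ≡ false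
open Graph public

-- Multivariate integer polynomials in variables x_0 … x_{n-1},
-- represented as (unnormalised) lists of terms  c · ∏ x_i^{e_i}.

Monomial : ℕ → Set
Monomial n = Vec ℕ n

Poly : ℕ → Set
Poly n = List (ℤ × Monomial n)

unitMon : ∀ {n} → Fin n → Monomial n
unitMon i = tabulate (λ j → if does (FinP._≟_ i j) then 1 else 0)

var : ∀ {n} → Fin n → Poly n
var i = (ℤ.+ 1 , unitMon i) ∷ []

one : ∀ {n} → Poly n
one = (ℤ.+ 1 , replicate _ 0) ∷ []

_-P_ : ∀ {n} → Poly n → Poly n → Poly n
p -P q = p ++ map (λ t → (ℤ.- proj₁ t , proj₂ t)) q

_*P_ : ∀ {n} → Poly n → Poly n → Poly n
p *P q = concatMap (λ s → map (λ t → (proj₁ s ℤ.* proj₁ t , zipWith _+_ (proj₂ s) (proj₂ t))) q) p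

productP : ∀ {n} → List (Poly n) → Poly n
productP = foldr _*P_ one

coeff : ∀ {n} → Poly n → Monomial n → ℤ
coeff [] m = ℤ.+ 0
coeff ((c , m') ∷ p) m with VecP.≡-dec Data.Nat._≟_ m' m
... | Relation.Nullary.yes _ = c ℤ.+ coeff p m
... | Relation.Nullary.no  _ = coeff p m

-- Graph polynomial P_G = ∏_{uv ∈ E(G), u < v} (x_u − x_v),
-- with the ordering of V(G) = Fin n the natural one.

edgePairs : ∀ {n} → Graph n → List (Fin n × Fin n)
edgePairs {n} G =
  concatMap (λ u → concatMap (λ v →
      if does (u <? v) ∧ adj G u v then (u , v) ∷ [] else []) (allFin n))
    (allFin n)

graphPoly : ∀ {n} → Graph n → Poly n
graphPoly G = productP (map (λ e → var (proj₁ e) -P var (proj₂ e)) (edgePairs G))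

IsAT : ∀ {n} → Graph n → (Fin n → ℕ) → Set
IsAT {n} G f = Σ (Fin n → ℕ) λ t →
  (∀ v → t v + 1 ≤ f v) × (coeff (graphPoly G) (tabulate t) ≢ ℤ.+ 0)

-- Weak* degeneracy.
-- A state is (alive, E, f): the current graph has vertex set
-- {v | alive v ≡ true} and edge set {uv | E u v ≡ true, u, v alive}.

update : ∀ {n} → (Fin n → ℕ) → Fin n → ℕ → (Fin n → ℕ)
update f x a v = if does (FinP._≟_ x v) then a else f v

kill : ∀ {n} → (Fin n → Bool) → Fin n → (Fin n → Bool)
kill alive x v = if does (FinP._≟_ x v) then false else alive v

removeEdge : ∀ {n} → (Fin n → Fin n → Bool) → Fin n → Fin n → (Fin n → Fin n → Bool)
removeEdge E x y u v =
  if (does (FinP._≟_ u x) ∧ does (FinP._≟_ v y)) Data.Bool.∨ (does (FinP._≟_ u y) ∧ does (FinP._≟_ v x))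
  then false else E u v

data WDStar {n : ℕ} : (Fin n → Bool) → (Fin n → Fin n → Bool) → (Fin n → ℕ) → Set where
  done : ∀ {alive E f} → (∀ v → alive v ≡ false) → WDStar alive E f
  reduceValue : ∀ {alive E f} (x : Fin n) (s : ℕ) →
    alive x ≡ true → 0 < s → s < f x →
    WDStar alive E (update f x (f x ∸ s)) → WDStar alive E f
  edgeDelete : ∀ {alive E f} (x y : Fin n) →
    alive x ≡ true → alive y ≡ true → E x y ≡ true → f y < f x →
    WDStar alive (removeEdge E x y) (update f x (f x ∸ f y)) → WDStar alive E f
  vertexDelete : ∀ {alive E f} (x : Fin n) →
    alive x ≡ true → 0 < f x →
    WDStar (kill alive x) E (λ v → if alive v ∧ E x v then f v ∸ 1 else f v) →
    WDStar alive E f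

IsWeakStarDegenerate : ∀ {n} → Graph n → (Fin n → ℕ) → Set
IsWeakStarDegenerate G f = WDStar (λ _ → true) (adj G) f

-- Follow the weak* degeneracy sequence from the empty graph back to G, keeping a list L of the edges
-- present and an exponent t, below f on live vertices and 0 on deleted ones, such that x^t has a
-- nonzero coefficient in ∏_{uv ∈ L} (x_u − x_v).  Lowering a value keeps t.  Restoring a vertex x adds
-- the factors at x; since t x = 0 each of them can only contribute its other end, so raising t by one
-- at every neighbour of x keeps the coefficient nonzero, and f was lowered exactly there.  Restoring an
-- edge xy with f y < f x: the coefficients of (x_x − x_y)·Q at t + (k+1)·e_x − k·e_y for k = 0 … t y
-- telescope to the coefficient of x^t in Q, so one of them is nonzero, and there the exponent of x is
-- at most t x + t y + 1 < f x.

module Submission where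

open import Defs hiding (sym)
open import Data.Nat as ℕ using (ℕ; zero; suc; _+_; _∸_; _<_; _≤_; z≤n; s≤s)
import Data.Nat.Properties as ℕ
open import Data.Integer as ℤ using (ℤ; 0ℤ; _-_)
import Data.Integer.Properties as ℤ
open import Data.Integer.Tactic.RingSolver using (solve-∀)
open import Data.Nat.Tactic.RingSolver using () renaming (solve-∀ to ℕ-solve-∀)
open import Data.Fin using (Fin; _<?_) renaming (zero to fzero; suc to fsuc)
import Data.Fin.Properties as Fin
open import Data.Fin.Properties using (_≟_)
open import Data.Vec using (tabulate; zipWith; replicate; lookup)
import Data.Vec.Properties as Vec
open import Data.Product using (_×_; _,_; proj₁; proj₂; Σ; uncurry)
open import Data.Sum using (_⊎_; inj₁; inj₂) renaming (swap to ⊎-swap)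
open import Data.List using (List; []; _∷_; _++_; map; filter; length; concat; concatMap; allFin)
import Data.List as List
import Data.List.Properties as List
open import Data.List.Relation.Unary.All as All using (All; []; _∷_)
open import Data.List.Relation.Unary.All.Properties using (all-filter; ¬Any⇒All¬) renaming (filter⁺ to All-filter⁺)
import Data.List.Relation.Binary.Permutation.Propositional.Properties as ↭
open import Data.List.Relation.Binary.Permutation.Propositional as ↭ using (_↭_)
open import Relation.Nullary using (¬_; Dec; does; yes; no; contradiction)
open import Relation.Nullary.Decidable using (map′; _×-dec_; _⊎-dec_; ¬?; dec-true; dec-false)
open import Relation.Binary.Definitions using (DecidableEquality; tri<; tri≈; tri>)
open import Function using (_∘_)
open import Data.Bool using (Bool; true; false; _∧_; if_then_else_)
open import Data.Bool.Properties using (∧-zeroʳ)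
open import Relation.Binary.PropositionalEquality

module _ {n : ℕ} where

  Exponent : Set
  Exponent = Fin n → ℕ

  Congruent : (Exponent → ℤ) → Set
  Congruent g = ∀ {S T} → S ≗ T → g S ≡ g T

  update-self : ∀ (f : Exponent) x a → update f x a x ≡ a
  update-self f x a with x ≟ x
  ... | yes _ = refl
  ... | no x≢x = contradiction refl x≢x

  update-other : ∀ (f : Exponent) {x} a {v} → x ≢ v → update f x a v ≡ f v
  update-other f {x} a {v} x≢v with x ≟ v
  ... | yes x≡v = contradiction x≡v x≢v
  ... | no _ = refl

  lower : Fin n → Exponent → Exponent
  lower u T = update T u (T u ∸ 1)

  raise : Fin n → Exponent → Exponent
  raise u S = update S u (suc (S u))

  lower-cong : ∀ u {S T} → S ≗ T → lower u S ≗ lower u T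
  lower-cong u {S} {T} S≗T v with u ≟ v
  ... | yes refl = cong (_∸ 1) (S≗T u)
  ... | no _ = S≗T v

  raise-cong : ∀ u {S T} → S ≗ T → raise u S ≗ raise u T
  raise-cong u S≗T v with u ≟ v
  ... | yes refl = cong suc (S≗T u)
  ... | no _ = S≗T v

  lower-raise : ∀ u S → lower u (raise u S) ≗ S
  lower-raise u S v with u ≟ v
  ... | yes refl = cong (_∸ 1) (update-self S u _)
  ... | no _ = refl

  raise-lower : ∀ u {T} k → T u ≡ suc k → raise u (lower u T) ≗ T
  raise-lower u {T} k Tu≡1+k v with u ≟ v
  ... | yes refl = trans (cong suc (trans (update-self T u _) (cong (_∸ 1) Tu≡1+k))) (sym Tu≡1+k)
  ... | no _ = refl

  lower-comm : ∀ u w T → lower u (lower w T) ≗ lower w (lower u T)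
  lower-comm u w T v with u ≟ v | w ≟ v
  ... | yes refl | yes refl = refl
  ... | yes refl | no w≢u = cong (_∸ 1) (update-other T _ w≢u)
  ... | no u≢w | yes refl = sym (cong (_∸ 1) (update-other T _ u≢w))
  ... | no _ | no _ = refl

  whenPositive : ℕ → ℤ → ℤ
  whenPositive zero    _ = 0ℤ
  whenPositive (suc _) z = z

  -- If g lists the coefficients of a polynomial p, then timesVar u g lists those of x_u · p.
  timesVar : Fin n → (Exponent → ℤ) → Exponent → ℤ
  timesVar u g T = whenPositive (T u) (g (lower u T))

  timesVar-cong : ∀ u {g} → Congruent g → Congruent (timesVar u g)
  timesVar-cong u g-cong S≗T = cong₂ whenPositive (S≗T u) (g-cong (lower-cong u S≗T))

  timesVar-suc : ∀ u g {T} k → T u ≡ suc k → timesVar u g T ≡ g (lower u T)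
  timesVar-suc u g {T} k Tu≡1+k = cong (λ a → whenPositive a (g (lower u T))) Tu≡1+k

  timesVar-zero : ∀ u g {T} → T u ≡ 0 → timesVar u g T ≡ 0ℤ
  timesVar-zero u g {T} Tu≡0 = cong (λ a → whenPositive a (g (lower u T))) Tu≡0

  timesVar-comm : ∀ u w {g} → Congruent g → ∀ T → timesVar u (timesVar w g) T ≡ timesVar w (timesVar u g) T
  timesVar-comm u w {g} g-cong T = byCases (u ≟ w)
    where
    swapGuards : ∀ a b z → whenPositive a (whenPositive b z) ≡ whenPositive b (whenPositive a z)
    swapGuards zero    zero    _ = refl
    swapGuards zero    (suc _) _ = refl
    swapGuards (suc _) zero    _ = refl
    swapGuards (suc _) (suc _) _ = refl

    byCases : Dec (u ≡ w) → timesVar u (timesVar w g) T ≡ timesVar w (timesVar u g) T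
    byCases (yes refl) = refl
    byCases (no u≢w) = begin
      whenPositive (T u) (whenPositive (lower u T w) (g (lower w (lower u T))))
        ≡⟨ cong₂ (λ a z → whenPositive (T u) (whenPositive a z)) (update-other T _ u≢w) (g-cong (lower-comm w u T)) ⟩
      whenPositive (T u) (whenPositive (T w) (g (lower u (lower w T))))
        ≡⟨ swapGuards (T u) (T w) _ ⟩
      whenPositive (T w) (whenPositive (T u) (g (lower u (lower w T))))
        ≡⟨ cong (λ a → whenPositive (T w) (whenPositive a (g (lower u (lower w T))))) (update-other T _ (u≢w ∘ sym)) ⟨
      whenPositive (T w) (whenPositive (lower w T u) (g (lower u (lower w T)))) ∎
      where open ≡-Reasoning

  timesVar-sub : ∀ u g h T → timesVar u (λ S → g S - h S) T ≡ timesVar u g T - timesVar u h T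
  timesVar-sub u g h T with T u
  ... | zero = refl
  ... | suc _ = refl

  Edge : Set
  Edge = Fin n × Fin n

  -- Unlike the product instance in the library, this decision computes to a conjunction of
  -- vertex comparisons, which is the form in which removeEdge is written.
  _≟ₑ_ : DecidableEquality Edge
  (a , b) ≟ₑ (c , d) = map′ (uncurry (cong₂ _,_)) (λ { refl → refl , refl }) ((a ≟ c) ×-dec (b ≟ d))

  Joins : Fin n → Fin n → Edge → Set
  Joins x y e = e ≡ (x , y) ⊎ e ≡ (y , x)

  joins? : ∀ x y e → Dec (Joins x y e)
  joins? x y e = (e ≟ₑ (x , y)) ⊎-dec (e ≟ₑ (y , x))

  joins-trans : ∀ {x y u v e} → Joins x y e → Joins u v e → Joins x y (u , v)
  joins-trans (inj₁ refl) (inj₁ refl) = inj₁ refl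
  joins-trans (inj₁ refl) (inj₂ refl) = inj₂ refl
  joins-trans (inj₂ refl) (inj₁ refl) = inj₂ refl
  joins-trans (inj₂ refl) (inj₂ refl) = inj₁ refl

  joins-other-end : ∀ {x b v e} → b ≢ x → Joins x b e → Joins x v e → b ≡ v
  joins-other-end b≢x (inj₁ refl) (inj₁ refl) = refl
  joins-other-end b≢x (inj₁ refl) (inj₂ refl) = contradiction refl b≢x
  joins-other-end b≢x (inj₂ refl) (inj₁ refl) = contradiction refl b≢x
  joins-other-end b≢x (inj₂ refl) (inj₂ refl) = refl

  -- factorCoeff L lists the coefficients of ∏_{(u , v) ∈ L} (x_u − x_v).
  factorCoeff : List Edge → Exponent → ℤ
  factorCoeff []            T = coeff one (tabulate T)
  factorCoeff ((u , v) ∷ L) T = timesVar u (factorCoeff L) T - timesVar v (factorCoeff L) T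

  factorCoeff-cong : ∀ L → Congruent (factorCoeff L)
  factorCoeff-cong []            S≗T = cong (coeff one) (Vec.tabulate-cong S≗T)
  factorCoeff-cong ((u , v) ∷ L) S≗T =
    cong₂ _-_ (timesVar-cong u (factorCoeff-cong L) S≗T) (timesVar-cong v (factorCoeff-cong L) S≗T)

  factorCoeff-∷ : ∀ e L L′ → (∀ T → factorCoeff L T ≡ factorCoeff L′ T) →
                  ∀ T → factorCoeff (e ∷ L) T ≡ factorCoeff (e ∷ L′) T
  factorCoeff-∷ (u , v) _ _ L≡L′ T =
    cong₂ _-_ (cong (whenPositive (T u)) (L≡L′ (lower u T))) (cong (whenPositive (T v)) (L≡L′ (lower v T)))

  factorCoeff-swap : ∀ a b L T → factorCoeff (a ∷ b ∷ L) T ≡ factorCoeff (b ∷ a ∷ L) T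
  factorCoeff-swap (a₁ , a₂) (b₁ , b₂) L T = begin
    timesVar a₁ (factorCoeff ((b₁ , b₂) ∷ L)) T - timesVar a₂ (factorCoeff ((b₁ , b₂) ∷ L)) T
      ≡⟨ cong₂ _-_ (timesVar-sub a₁ (tv b₁) (tv b₂) T) (timesVar-sub a₂ (tv b₁) (tv b₂) T) ⟩
    (x a₁ b₁ - x a₁ b₂) - (x a₂ b₁ - x a₂ b₂)
      ≡⟨ cong₂ _-_ (cong₂ _-_ (comm a₁ b₁) (comm a₁ b₂)) (cong₂ _-_ (comm a₂ b₁) (comm a₂ b₂)) ⟩
    (x b₁ a₁ - x b₂ a₁) - (x b₁ a₂ - x b₂ a₂)
      ≡⟨ interchange (x b₁ a₁) (x b₂ a₁) (x b₁ a₂) (x b₂ a₂) ⟩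
    (x b₁ a₁ - x b₁ a₂) - (x b₂ a₁ - x b₂ a₂)
      ≡⟨ cong₂ _-_ (timesVar-sub b₁ (tv a₁) (tv a₂) T) (timesVar-sub b₂ (tv a₁) (tv a₂) T) ⟨
    timesVar b₁ (factorCoeff ((a₁ , a₂) ∷ L)) T - timesVar b₂ (factorCoeff ((a₁ , a₂) ∷ L)) T ∎
    where
    open ≡-Reasoning
    tv : Fin n → Exponent → ℤ
    tv u = timesVar u (factorCoeff L)
    x : Fin n → Fin n → ℤ
    x u w = timesVar u (tv w) T
    comm : ∀ u w → x u w ≡ x w u
    comm u w = timesVar-comm u w (factorCoeff-cong L) T
    interchange : ∀ a b c d → (a - b) - (c - d) ≡ (a - c) - (b - d)
    interchange = solve-∀

  factorCoeff-↭ : ∀ {L L′} → L ↭ L′ → ∀ T → factorCoeff L T ≡ factorCoeff L′ T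
  factorCoeff-↭ ↭.refl                   T = refl
  factorCoeff-↭ (↭.prep {L} {L′} e L↭L′) T = factorCoeff-∷ e L L′ (factorCoeff-↭ L↭L′) T
  factorCoeff-↭ (↭.swap {L} {L′} a b L↭L′) T =
    trans (factorCoeff-swap a b L T) (factorCoeff-∷ b (a ∷ L) (a ∷ L′) (factorCoeff-∷ a L L′ (factorCoeff-↭ L↭L′)) T)
  factorCoeff-↭ (↭.trans L↭M M↭L′)       T = trans (factorCoeff-↭ L↭M T) (factorCoeff-↭ M↭L′ T)

  reorient : ∀ {x y e} M T → Joins x y e → factorCoeff ((x , y) ∷ M) T ≢ 0ℤ → factorCoeff (e ∷ M) T ≢ 0ℤ
  reorient M T (inj₁ refl) nz = nz
  reorient {x} {y} M T (inj₂ refl) nz = nz ∘ ℤ.i≡j⇒i-j≡0 ∘ sym ∘ ℤ.i-j≡0⇒i≡j (timesVar y (factorCoeff M) T) _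

  tabulate-injective : ∀ {S T : Exponent} → tabulate S ≡ tabulate T → S ≗ T
  tabulate-injective {S} {T} eq v =
    trans (sym (Vec.lookup∘tabulate S v)) (trans (cong (λ w → lookup w v) eq) (Vec.lookup∘tabulate T v))

  unitMon-+ : ∀ u s → zipWith _+_ (unitMon u) s ≡ tabulate (raise u (lookup s))
  unitMon-+ u s = trans (sym (Vec.tabulate∘lookup _)) (Vec.tabulate-cong pointwise)
    where
    pointwise : ∀ i → lookup (zipWith _+_ (unitMon u) s) i ≡ raise u (lookup s) i
    pointwise i rewrite Vec.lookup-zipWith _+_ i (unitMon u) s | Vec.lookup∘tabulate (λ j → if does (u ≟ j) then 1 else 0) i
      with u ≟ i
    ... | yes refl = refl
    ... | no _ = refl

  coeff-++ : ∀ (p q : Poly n) M → coeff (p ++ q) M ≡ coeff p M ℤ.+ coeff q M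
  coeff-++ []            q M = sym (ℤ.+-identityˡ _)
  coeff-++ ((c , s) ∷ p) q M with Vec.≡-dec ℕ._≟_ s M
  ... | yes _ = trans (cong (λ z → c ℤ.+ z) (coeff-++ p q M)) (sym (ℤ.+-assoc c _ _))
  ... | no _ = coeff-++ p q M

  rescale : ℤ → (Monomial n → Monomial n) → Poly n → Poly n
  rescale c g = map (λ t → (c ℤ.* proj₁ t , g (proj₂ t)))

  coeff-rescale : ∀ c g Q {M M′} → g M′ ≡ M → (∀ s → g s ≡ M → s ≡ M′) →
                  coeff (rescale c g Q) M ≡ c ℤ.* coeff Q M′
  coeff-rescale c g []            _     _   = sym (ℤ.*-zeroʳ c)
  coeff-rescale c g ((a , s) ∷ Q) {M} {M′} hit inj with Vec.≡-dec ℕ._≟_ (g s) M | Vec.≡-dec ℕ._≟_ s M′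
  ... | yes _   | yes _    = trans (cong (λ z → c ℤ.* a ℤ.+ z) (coeff-rescale c g Q hit inj)) (sym (ℤ.*-distribˡ-+ c a _))
  ... | yes gs≡M | no s≢M′ = contradiction (inj s gs≡M) s≢M′
  ... | no gs≢M | yes refl = contradiction hit gs≢M
  ... | no _    | no _     = coeff-rescale c g Q hit inj

  coeff-rescale-miss : ∀ c g Q {M} → (∀ s → g s ≢ M) → coeff (rescale c g Q) M ≡ 0ℤ
  coeff-rescale-miss c g []            miss = refl
  coeff-rescale-miss c g ((a , s) ∷ Q) {M} miss with Vec.≡-dec ℕ._≟_ (g s) M
  ... | yes gs≡M = contradiction gs≡M (miss s)
  ... | no _ = coeff-rescale-miss c g Q miss

  coeff-timesVar : ∀ c u Q T → coeff (rescale c (zipWith _+_ (unitMon u)) Q) (tabulate T)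
                             ≡ c ℤ.* timesVar u (λ S → coeff Q (tabulate S)) T
  coeff-timesVar c u Q T = byValue (T u) refl
    where
    byValue : ∀ a → T u ≡ a → coeff (rescale c (zipWith _+_ (unitMon u)) Q) (tabulate T)
                             ≡ c ℤ.* whenPositive a (coeff Q (tabulate (lower u T)))
    byValue zero Tu≡0 = trans (coeff-rescale-miss c _ Q miss) (sym (ℤ.*-zeroʳ c))
      where
      miss : ∀ s → zipWith _+_ (unitMon u) s ≢ tabulate T
      miss s eq with () ← trans (sym (update-self (lookup s) u _))
                                (trans (tabulate-injective (trans (sym (unitMon-+ u s)) eq) u) Tu≡0)
    byValue (suc k) Tu≡1+k = coeff-rescale c _ Q hit inj
      where
      hit : zipWith _+_ (unitMon u) (tabulate (lower u T)) ≡ tabulate T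
      hit = trans (unitMon-+ u _) (Vec.tabulate-cong λ v →
              trans (raise-cong u (Vec.lookup∘tabulate (lower u T)) v) (raise-lower u k Tu≡1+k v))
      inj : ∀ s → zipWith _+_ (unitMon u) s ≡ tabulate T → s ≡ tabulate (lower u T)
      inj s eq = trans (sym (Vec.tabulate∘lookup s)) (Vec.tabulate-cong λ v →
                   trans (sym (lower-raise u (lookup s) v))
                         (lower-cong u (tabulate-injective (trans (sym (unitMon-+ u s)) eq)) v))

  factor : Edge → Poly n
  factor e = var (proj₁ e) -P var (proj₂ e)

  coeff-productFactors : ∀ L T → coeff (productP (map factor L)) (tabulate T) ≡ factorCoeff L T
  coeff-productFactors []            T = refl
  coeff-productFactors ((u , v) ∷ L) T = begin
    coeff (shiftU ++ (shiftV ++ [])) (tabulate T)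
      ≡⟨ trans (coeff-++ shiftU (shiftV ++ []) _) (cong (λ z → coeff shiftU (tabulate T) ℤ.+ z) (coeff-++ shiftV [] _)) ⟩
    coeff shiftU (tabulate T) ℤ.+ (coeff shiftV (tabulate T) ℤ.+ 0ℤ)
      ≡⟨ cong₂ (λ a b → a ℤ.+ (b ℤ.+ 0ℤ)) (coeff-timesVar (ℤ.+ 1) u Q T) (coeff-timesVar ℤ.-1ℤ v Q T) ⟩
    ℤ.+ 1 ℤ.* timesVar u coeffQ T ℤ.+ (ℤ.-1ℤ ℤ.* timesVar v coeffQ T ℤ.+ 0ℤ)
      ≡⟨ difference (timesVar u coeffQ T) (timesVar v coeffQ T) ⟩
    timesVar u coeffQ T - timesVar v coeffQ T
      ≡⟨ cong₂ _-_ (cong (whenPositive (T u)) (coeff-productFactors L (lower u T)))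
                   (cong (whenPositive (T v)) (coeff-productFactors L (lower v T))) ⟩
    factorCoeff ((u , v) ∷ L) T ∎
    where
    open ≡-Reasoning
    Q = productP (map factor L)
    shiftU shiftV : Poly n
    shiftU = rescale (ℤ.+ 1) (zipWith _+_ (unitMon u)) Q
    shiftV = rescale ℤ.-1ℤ (zipWith _+_ (unitMon v)) Q
    coeffQ : Exponent → ℤ
    coeffQ S = coeff Q (tabulate S)
    difference : ∀ a b → ℤ.+ 1 ℤ.* a ℤ.+ (ℤ.-1ℤ ℤ.* b ℤ.+ 0ℤ) ≡ a - b
    difference = solve-∀

  coeff-one-zero : coeff {n} one (tabulate (λ _ → 0)) ≡ ℤ.+ 1
  coeff-one-zero with Vec.≡-dec ℕ._≟_ (replicate n 0) (tabulate (λ _ → 0))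
  ... | yes _ = refl
  ... | no r≢t = contradiction (trans (sym (Vec.tabulate∘lookup _)) (Vec.tabulate-cong (λ i → Vec.lookup-replicate i 0))) r≢t

  removeEdge-joins : ∀ E {x y u v} → Joins x y (u , v) → removeEdge E x y u v ≡ false
  removeEdge-joins E {x} {y} {u} {v} j = cong (λ b → if b then false else E u v) (dec-true (joins? x y (u , v)) j)

  removeEdge-apart : ∀ E {x y u v} → ¬ Joins x y (u , v) → removeEdge E x y u v ≡ E u v
  removeEdge-apart E {x} {y} {u} {v} ¬j = cong (λ b → if b then false else E u v) (dec-false (joins? x y (u , v)) ¬j)

  multiplicity : Edge → List Edge → ℕ
  multiplicity e L = length (filter (_≟ₑ e) L)

  multiplicity-here : ∀ e L → multiplicity e (e ∷ L) ≡ suc (multiplicity e L)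
  multiplicity-here e L = cong length (List.filter-accept (_≟ₑ e) refl)

  multiplicity-there : ∀ a {e} L → a ≢ e → multiplicity e (a ∷ L) ≡ multiplicity e L
  multiplicity-there _ L a≢e = cong length (List.filter-reject (_≟ₑ _) a≢e)

  multiplicity-++ : ∀ e L M → multiplicity e (L ++ M) ≡ multiplicity e L + multiplicity e M
  multiplicity-++ e L M = trans (cong length (List.filter-++ (_≟ₑ e) L M)) (List.length-++ (filter (_≟ₑ e) L))

  multiplicity-↭ : ∀ e {L M} → L ↭ M → multiplicity e L ≡ multiplicity e M
  multiplicity-↭ e L↭M = ↭.↭-length (↭.filter-↭ (_≟ₑ e) L↭M)

  multiplicity-filter : ∀ {P : Edge → Set} (P? : ∀ e → Dec (P e)) {e} L → ¬ P e → multiplicity e (filter P? L) ≡ 0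
  multiplicity-filter {P} P? {e} L ¬Pe =
    cong length (List.filter-none (_≟ₑ e) (All.map (λ Pa a≡e → ¬Pe (subst P a≡e Pa)) (all-filter P? L)))

  multiplicity≡0⇒All≢ : ∀ e L → multiplicity e L ≡ 0 → All (_≢ e) L
  multiplicity≡0⇒All≢ e L m≡0 = ¬Any⇒All¬ L (λ any → ℕ.<⇒≢ (List.filter-some (_≟ₑ e) any) (sym m≡0))

  multiplicity>0⇒↭ : ∀ e L → 0 < multiplicity e L → Σ (List Edge) λ R → L ↭ e ∷ R
  multiplicity>0⇒↭ e (a ∷ L) m>0 with a ≟ₑ e
  ... | yes refl = L , ↭.refl
  ... | no a≢e with multiplicity>0⇒↭ e L (subst (0 <_) (multiplicity-there a L a≢e) m>0)
  ...   | R , L↭e∷R = a ∷ R , ↭.trans (↭.prep a L↭e∷R) (↭.swap a e ↭.refl)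

  links : Fin n → Fin n → List Edge → ℕ
  links u v L = multiplicity (u , v) L + multiplicity (v , u) L

  links-sym : ∀ u v L → links u v L ≡ links v u L
  links-sym u v L = ℕ.+-comm (multiplicity (u , v) L) _

  links-joins : ∀ {x y u v} L → Joins x y (u , v) → links u v L ≡ links x y L
  links-joins L (inj₁ refl) = refl
  links-joins L (inj₂ refl) = links-sym _ _ L

  links-↭ : ∀ u v {L M} → L ↭ M → links u v L ≡ links u v M
  links-↭ u v L↭M = cong₂ _+_ (multiplicity-↭ (u , v) L↭M) (multiplicity-↭ (v , u) L↭M)

  links-++ : ∀ u v L M → links u v (L ++ M) ≡ links u v L + links u v M
  links-++ u v L M = trans (cong₂ _+_ (multiplicity-++ (u , v) L M) (multiplicity-++ (v , u) L M))
                            (interchange (multiplicity (u , v) L) _ (multiplicity (v , u) L) _)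
    where
    interchange : ∀ a b c d → (a + b) + (c + d) ≡ (a + c) + (b + d)
    interchange = ℕ-solve-∀

  links-∷-joins : ∀ {u v e} L → u ≢ v → Joins u v e → links u v (e ∷ L) ≡ suc (links u v L)
  links-∷-joins {u} {v} L u≢v (inj₁ refl) =
    cong₂ _+_ (multiplicity-here (u , v) L) (multiplicity-there (u , v) L (u≢v ∘ cong proj₁))
  links-∷-joins {u} {v} L u≢v (inj₂ refl) =
    trans (cong₂ _+_ (multiplicity-there (v , u) L (u≢v ∘ cong proj₂)) (multiplicity-here (v , u) L)) (ℕ.+-suc _ _)

  links-∷-apart : ∀ {u v e} L → ¬ Joins u v e → links u v (e ∷ L) ≡ links u v L
  links-∷-apart {e = e} L ¬j = cong₂ _+_ (multiplicity-there e L (¬j ∘ inj₁)) (multiplicity-there e L (¬j ∘ inj₂))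

  links-filter-reject : ∀ {P : Edge → Set} (P? : ∀ e → Dec (P e)) L {u v} → ¬ P (u , v) → ¬ P (v , u) →
                        links u v (filter P? L) ≡ 0
  links-filter-reject P? L ¬Puv ¬Pvu = cong₂ _+_ (multiplicity-filter P? L ¬Puv) (multiplicity-filter P? L ¬Pvu)

  links>0⇒↭ : ∀ x y L → 0 < links x y L → Σ Edge λ e → Σ (List Edge) λ R → Joins x y e × L ↭ e ∷ R
  links>0⇒↭ x y L l>0 with multiplicity (x , y) L in m≡
  ... | suc _ = (x , y) , proj₁ R , inj₁ refl , proj₂ R
    where R = multiplicity>0⇒↭ (x , y) L (subst (0 <_) (sym m≡) (s≤s z≤n))
  ... | zero = (y , x) , proj₁ R , inj₂ refl , proj₂ R
    where R = multiplicity>0⇒↭ (y , x) L l>0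

  indicator : Bool → ℕ
  indicator b = if b then 1 else 0

  indicator≤1 : ∀ b → indicator b ≤ 1
  indicator≤1 false = z≤n
  indicator≤1 true  = s≤s z≤n

  indicator-∧-false : ∀ a b → indicator (a ∧ b ∧ false) ≡ 0
  indicator-∧-false a b rewrite ∧-zeroʳ b | ∧-zeroʳ a = refl

  record Represents (alive : Fin n → Bool) (E : Fin n → Fin n → Bool) (L : List Edge) : Set where
    constructor represents
    field counts : ∀ u v → links u v L ≡ indicator (alive u ∧ alive v ∧ E u v)
  open Represents

  -- A loop would be counted twice by links, but the indicator is at most 1.
  represents-loopless : ∀ {alive E L} → Represents alive E L → ∀ v → multiplicity (v , v) L ≡ 0
  represents-loopless {alive} {E} {L} rep v = atMostHalf (multiplicity (v , v) L) (alive v ∧ alive v ∧ E v v) (counts rep v v)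
    where
    atMostHalf : ∀ m b → m + m ≡ indicator b → m ≡ 0
    atMostHalf zero    _     _  = refl
    atMostHalf (suc m) false eq with () ← eq
    atMostHalf (suc m) true  eq with () ← trans (sym (ℕ.+-suc m m)) (ℕ.suc-injective eq)

  represents-dead : ∀ {alive E} L → (∀ v → alive v ≡ false) → Represents alive E L → L ≡ []
  represents-dead               []            _    _   = refl
  represents-dead {alive} {E} ((u , v) ∷ L) dead rep
    with () ← trans (sym (cong (_+ multiplicity (v , u) ((u , v) ∷ L)) (multiplicity-here (u , v) L)))
                    (trans (counts rep u v) (cong (λ b → indicator (b ∧ alive v ∧ E u v)) (dead u)))

  represents-edge : ∀ {alive E L x y} → Represents alive E L → alive x ≡ true → alive y ≡ true → E x y ≡ true →
                    links x y L ≡ 1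
  represents-edge {E = E} {x = x} {y} rep ax ay exy =
    trans (counts rep x y) (cong indicator (trans (cong₂ (λ a b → a ∧ b ∧ E x y) ax ay) exy))

  represents-edge-proper : ∀ {alive E L x y} → Represents alive E L → links x y L ≡ 1 → x ≢ y
  represents-edge-proper {x = x} rep xy-edge refl with () ← trans (sym xy-edge) (cong (λ m → m + m) (represents-loopless rep x))

  record Admissible (alive : Fin n → Bool) (f t : Exponent) : Set where
    field
      below  : ∀ v → alive v ≡ true → t v < f v
      vanish : ∀ v → alive v ≡ false → t v ≡ 0
  open Admissible

  ATWitness : (Fin n → Bool) → Exponent → List Edge → Set
  ATWitness alive f L = Σ Exponent λ t → Admissible alive f t × factorCoeff L t ≢ 0ℤ

  admissible-weaken : ∀ {alive f f′ t} → (∀ v → f′ v ≤ f v) → Admissible alive f′ t → Admissible alive f t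
  admissible-weaken f′≤f adm = record
    { below  = λ v av → ℕ.<-≤-trans (below adm v av) (f′≤f v)
    ; vanish = vanish adm }

  update-decrease : ∀ (f : Exponent) x s v → update f x (f x ∸ s) v ≤ f v
  update-decrease f x s v = byCases (x ≟ v)
    where
    byCases : Dec (x ≡ v) → update f x (f x ∸ s) v ≤ f v
    byCases (yes refl) = ℕ.≤-trans (ℕ.≤-reflexive (update-self f x _)) (ℕ.m∸n≤m (f x) s)
    byCases (no x≢v)   = ℕ.≤-reflexive (update-other f _ x≢v)

  done-AT : ∀ {alive E f L} → (∀ v → alive v ≡ false) → Represents alive E L → ATWitness alive f L
  done-AT {L = L} dead rep =
    (λ _ → 0) ,
    record { below = λ v av → contradiction (trans (sym av) (dead v)) λ () ; vanish = λ _ _ → refl } ,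
    λ z → contradiction (trans (sym coeff-one-zero) (subst (λ M → factorCoeff M (λ _ → 0) ≡ 0ℤ) (represents-dead L dead rep) z))
                        λ ()

  module Transfer (x y : Fin n) (x≢y : x ≢ y) (t : Exponent) where

    reassign : ℕ → ℕ → Exponent
    reassign a b = update (update t x a) y b

    reassign-x : ∀ {a b} → reassign a b x ≡ a
    reassign-x {a} {b} = trans (update-other (update t x a) b (x≢y ∘ sym)) (update-self t x a)

    reassign-y : ∀ {a b} → reassign a b y ≡ b
    reassign-y {a} {b} = update-self (update t x a) y b

    reassign-other : ∀ {a b v} → x ≢ v → y ≢ v → reassign a b v ≡ t v
    reassign-other {a} {b} x≢v y≢v = trans (update-other (update t x a) b y≢v) (update-other t a x≢v)

    reassign-id : reassign (t x) (t y) ≗ t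
    reassign-id v with x ≟ v | y ≟ v
    ... | _        | yes refl = refl
    ... | yes refl | no _     = refl
    ... | no _     | no _     = refl

    reassign-away : ∀ {a a′ b v} → x ≢ v → reassign a b v ≡ reassign a′ b v
    reassign-away {a} {a′} {b} {v} x≢v = byCases (y ≟ v)
      where
      byCases : Dec (y ≡ v) → reassign a b v ≡ reassign a′ b v
      byCases (yes refl) = trans reassign-y (sym reassign-y)
      byCases (no y≢v)   = trans (reassign-other x≢v y≢v) (sym (reassign-other x≢v y≢v))

    lower-x : ∀ a b → lower x (reassign (suc a) b) ≗ reassign a b
    lower-x a b v = byCases (x ≟ v)
      where
      T : Exponent
      T = reassign (suc a) b
      byCases : Dec (x ≡ v) → lower x (reassign (suc a) b) v ≡ reassign a b v
      byCases (yes refl) = trans (update-self T x (T x ∸ 1)) (trans (cong (_∸ 1) reassign-x) (sym reassign-x))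
      byCases (no x≢v)   = trans (update-other T (T x ∸ 1) x≢v) (reassign-away x≢v)

    lower-y : ∀ a b → lower y (reassign a (suc b)) ≗ reassign a b
    lower-y a b v = byCases (y ≟ v)
      where
      T : Exponent
      T = reassign a (suc b)
      byCases : Dec (y ≡ v) → lower y (reassign a (suc b)) v ≡ reassign a b v
      byCases (yes refl) = trans (update-self T y (T y ∸ 1)) (trans (cong (_∸ 1) reassign-y) (sym reassign-y))
      byCases (no y≢v)   = trans (update-other T (T y ∸ 1) y≢v)
                             (trans (update-other (update t x a) (suc b) y≢v) (sym (update-other (update t x a) b y≢v)))

    module _ {g} (g-cong : Congruent g) where

      timesVar-x : ∀ a b → timesVar x g (reassign (suc a) b) ≡ g (reassign a b)
      timesVar-x a b = trans (timesVar-suc x g a reassign-x) (g-cong (lower-x a b))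

      timesVar-y : ∀ a b → timesVar y g (reassign a (suc b)) ≡ g (reassign a b)
      timesVar-y a b = trans (timesVar-suc y g b reassign-y) (g-cong (lower-y a b))

      timesVar-y-zero : ∀ a → timesVar y g (reassign a 0) ≡ 0ℤ
      timesVar-y-zero a = timesVar-zero y g reassign-y

      Transferred : ℕ → ℕ → Set
      Transferred a b = Σ ℕ λ a′ → Σ ℕ λ b′ → a′ ≤ a + suc b × b′ ≤ b ×
                          timesVar x g (reassign a′ b′) - timesVar y g (reassign a′ b′) ≢ 0ℤ

      -- The coefficient of (x_x − x_y)·g at reassign (1 + a) b is g at reassign a b minus g at
      -- reassign (1 + a) (b − 1); these differences telescope as b decreases to 0.
      lift : ∀ b a → g (reassign a b) ≢ 0ℤ → Transferred a b
      lift zero a g≢0 = suc a , zero , ℕ.m<m+n a (s≤s z≤n) , z≤n , λ d≡0 →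
        g≢0 (trans (sym (trans (cong₂ _-_ (timesVar-x a 0) (timesVar-y-zero (suc a))) (ℤ.+-identityʳ _))) d≡0)
      lift (suc b) a g≢0 with timesVar x g (reassign (suc a) (suc b)) - timesVar y g (reassign (suc a) (suc b)) ℤ.≟ 0ℤ
      ... | no d≢0 = suc a , suc b , ℕ.m<m+n a (s≤s z≤n) , ℕ.≤-refl , d≢0
      ... | yes d≡0 = descend (lift b (suc a) (g≢0 ∘ trans shiftedEqual))
        where
        shiftedEqual : g (reassign a (suc b)) ≡ g (reassign (suc a) b)
        shiftedEqual = trans (sym (timesVar-x a (suc b))) (trans (ℤ.i-j≡0⇒i≡j _ _ d≡0) (timesVar-y (suc a) b))
        descend : Transferred (suc a) b → Transferred a (suc b)
        descend (a′ , b′ , a′≤ , b′≤ , nz) =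
          a′ , b′ , subst (a′ ≤_) (sym (ℕ.+-suc a (suc b))) a′≤ , ℕ.m≤n⇒m≤1+n b′≤ , nz

    admissible : ∀ {alive f a′ b′} → alive x ≡ true → alive y ≡ true → f y < f x →
                 Admissible alive (update f x (f x ∸ f y)) t → a′ ≤ t x + suc (t y) → b′ ≤ t y →
                 Admissible alive f (reassign a′ b′)
    admissible {alive} {f} {a′} {b′} ax ay fy<fx adm a′≤ b′≤ =
      record { below = λ v → below′ (x ≟ v) (y ≟ v) ; vanish = vanish′ }
      where
      ty<fy : t y < f y
      ty<fy = subst (t y <_) (update-other f (f x ∸ f y) x≢y) (below adm y ay)
      tx<fx-fy : t x < f x ∸ f y
      tx<fx-fy = subst (t x <_) (update-self f x (f x ∸ f y)) (below adm x ax)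
      below′ : ∀ {v} → Dec (x ≡ v) → Dec (y ≡ v) → alive v ≡ true → reassign a′ b′ v < f v
      below′ (yes refl) _ _ = subst (_< f x) (sym reassign-x) (ℕ.≤-<-trans a′≤
        (subst (t x + suc (t y) <_) (ℕ.m∸n+n≡m (ℕ.<⇒≤ fy<fx)) (ℕ.+-mono-<-≤ tx<fx-fy ty<fy)))
      below′ (no _) (yes refl) _ = subst (_< f y) (sym reassign-y) (ℕ.≤-<-trans b′≤ ty<fy)
      below′ {v} (no x≢v) (no y≢v) av =
        subst₂ _<_ (sym (reassign-other x≢v y≢v)) (update-other f (f x ∸ f y) x≢v) (below adm v av)
      vanish′ : ∀ v → alive v ≡ false → reassign a′ b′ v ≡ 0
      vanish′ v dv = trans (reassign-other (λ { refl → contradiction (trans (sym ax) dv) λ () })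
                                           (λ { refl → contradiction (trans (sym ay) dv) λ () }))
                           (vanish adm v dv)

  represents-removeEdge : ∀ {alive E x y e L R} → Represents alive E L → L ↭ e ∷ R → Joins x y e → x ≢ y →
                          Represents alive (removeEdge E x y) R
  represents-removeEdge {alive} {E} {x} {y} {e} {L} {R} rep L↭e∷R e-joins x≢y = represents count′
    where
    count′ : ∀ u v → links u v R ≡ indicator (alive u ∧ alive v ∧ removeEdge E x y u v)
    count′ u v with joins? x y (u , v)
    ... | yes uv-joins = begin
      links u v R  ≡⟨ links-joins R uv-joins ⟩
      links x y R  ≡⟨ ℕ.n≤0⇒n≡0 (ℕ.≤-pred (subst (_≤ 1) xy-count (indicator≤1 _))) ⟩
      0            ≡⟨ indicator-∧-false (alive u) (alive v) ⟨
      indicator (alive u ∧ alive v ∧ false)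
                   ≡⟨ cong (λ b → indicator (alive u ∧ alive v ∧ b)) (removeEdge-joins E uv-joins) ⟨
      indicator (alive u ∧ alive v ∧ removeEdge E x y u v) ∎
      where
      open ≡-Reasoning
      xy-count : indicator (alive x ∧ alive y ∧ E x y) ≡ suc (links x y R)
      xy-count = trans (sym (counts rep x y)) (trans (links-↭ x y L↭e∷R) (links-∷-joins R x≢y e-joins))
    ... | no ¬uv-joins = begin
      links u v R        ≡⟨ links-∷-apart R (¬uv-joins ∘ joins-trans e-joins) ⟨
      links u v (e ∷ R)  ≡⟨ links-↭ u v L↭e∷R ⟨
      links u v L        ≡⟨ counts rep u v ⟩
      indicator (alive u ∧ alive v ∧ E u v)
                         ≡⟨ cong (λ b → indicator (alive u ∧ alive v ∧ b)) (removeEdge-apart E ¬uv-joins) ⟨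
      indicator (alive u ∧ alive v ∧ removeEdge E x y u v) ∎
      where open ≡-Reasoning

  edgeDelete-AT : ∀ {alive E f x y} → alive x ≡ true → alive y ≡ true → E x y ≡ true → f y < f x →
    (∀ R → Represents alive (removeEdge E x y) R → ATWitness alive (update f x (f x ∸ f y)) R) →
    ∀ L → Represents alive E L → ATWitness alive f L
  edgeDelete-AT {alive} {E} {f} {x} {y} ax ay exy fy<fx IH L rep
    with e , R , e-joins , L↭e∷R ← links>0⇒↭ x y L (subst (0 <_) (sym (represents-edge rep ax ay exy)) (s≤s z≤n))
    with x≢y ← represents-edge-proper rep (represents-edge rep ax ay exy)
    with t , adm , nz ← IH R (represents-removeEdge rep L↭e∷R e-joins x≢y)
    with a′ , b′ , a′≤ , b′≤ , nz′ ← Transfer.lift x y x≢y t (factorCoeff-cong R) (t y) (t x)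
                                       (nz ∘ trans (sym (factorCoeff-cong R (Transfer.reassign-id x y x≢y t))))
    = Transfer.reassign x y x≢y t a′ b′
    , Transfer.admissible x y x≢y t ax ay fy<fx adm a′≤ b′≤
    , reorient R T e-joins nz′ ∘ trans (sym (factorCoeff-↭ L↭e∷R T))
    where T = Transfer.reassign x y x≢y t a′ b′

  kill-self : ∀ alive x → kill {n} alive x x ≡ false
  kill-self alive x with x ≟ x
  ... | yes _ = refl
  ... | no x≢x = contradiction refl x≢x

  kill-other : ∀ alive {x v} → x ≢ v → kill {n} alive x v ≡ alive v
  kill-other alive {x} {v} x≢v with x ≟ v
  ... | yes x≡v = contradiction x≡v x≢v
  ... | no _ = refl

  Incident : Fin n → Edge → Set
  Incident x e = proj₁ e ≡ x ⊎ proj₂ e ≡ x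

  incident? : ∀ x e → Dec (Incident x e)
  incident? x e = (proj₁ e ≟ x) ⊎-dec (proj₂ e ≟ x)

  Leaving : Fin n → Edge → Set
  Leaving x e = Σ (Fin n) λ b → b ≢ x × Joins x b e

  incident⇒leaving : ∀ {x e} → Incident x e → e ≢ (x , x) → Leaving x e
  incident⇒leaving {e = a , b} (inj₁ refl) e≢xx = b , (λ { refl → e≢xx refl }) , inj₁ refl
  incident⇒leaving {e = a , b} (inj₂ refl) e≢xx = a , (λ { refl → e≢xx refl }) , inj₂ refl

  ↭-filter-split : ∀ {P : Edge → Set} (P? : ∀ e → Dec (P e)) L → L ↭ filter P? L ++ filter (¬? ∘ P?) L
  ↭-filter-split P? []      = ↭.refl
  ↭-filter-split P? (a ∷ L) with P? a
  ... | yes _ = ↭.prep a (↭-filter-split P? L)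
  ... | no _  = ↭.trans (↭.prep a (↭-filter-split P? L)) (↭.↭-sym (↭.shift a (filter P? L) _))

  links-leaving-self : ∀ {x} I → All (Leaving x) I → links x x I ≡ 0
  links-leaving-self []      []                             = refl
  links-leaving-self (e ∷ I) ((b , b≢x , e-joins) ∷ leaving) =
    trans (links-∷-apart I (b≢x ∘ joins-other-end b≢x e-joins)) (links-leaving-self I leaving)

  -- An edge x b with x_x absent from the monomial can only contribute its term −x_b.
  lift-vertex : ∀ {x} N I t → All (Leaving x) I → t x ≡ 0 → factorCoeff N t ≢ 0ℤ →
                factorCoeff (I ++ N) (λ v → t v + links x v I) ≢ 0ℤ
  lift-vertex N []      t _ _ nz = nz ∘ trans (sym (factorCoeff-cong N (λ v → ℕ.+-identityʳ (t v))))
  lift-vertex {x} N (e ∷ I) t ((b , b≢x , e-joins) ∷ leaving) tx≡0 nz =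
    reorient (I ++ N) (raise b T₀) e-joins core ∘ trans (sym (factorCoeff-cong (e ∷ I ++ N) T≗raise))
    where
    g : Exponent → ℤ
    g = factorCoeff (I ++ N)
    T₀ T : Exponent
    T₀ v = t v + links x v I
    T  v = t v + links x v (e ∷ I)
    T≗raise : T ≗ raise b T₀
    T≗raise v = byCases (b ≟ v)
      where
      byCases : Dec (b ≡ v) → T v ≡ raise b T₀ v
      byCases (yes refl) = trans (cong (t b +_) (links-∷-joins I (b≢x ∘ sym) e-joins))
                                 (trans (ℕ.+-suc (t b) _) (sym (update-self T₀ b _)))
      byCases (no b≢v)   = trans (cong (t v +_) (links-∷-apart I (b≢v ∘ joins-other-end b≢x e-joins)))
                                 (sym (update-other T₀ _ b≢v))
    T₀x≡0 : T₀ x ≡ 0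
    T₀x≡0 = cong₂ _+_ tx≡0 (links-leaving-self I leaving)
    core : factorCoeff ((x , b) ∷ I ++ N) (raise b T₀) ≢ 0ℤ
    core eq = lift-vertex N I t leaving tx≡0 nz (ℤ.neg-injective (begin
      ℤ.- g T₀                                                ≡⟨ ℤ.+-identityˡ _ ⟨
      0ℤ - g T₀                                               ≡⟨ cong₂ (λ p q → p - q)
                                                                   (timesVar-zero x g {raise b T₀} (trans (update-other T₀ (suc (T₀ b)) b≢x) T₀x≡0))
                                                                   (trans (timesVar-suc b g (T₀ b) (update-self T₀ b _))
                                                                          (factorCoeff-cong (I ++ N) (lower-raise b T₀))) ⟨
      timesVar x g (raise b T₀) - timesVar b g (raise b T₀)  ≡⟨ eq ⟩
      0ℤ                                                      ∎))
      where open ≡-Reasoning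

  below-decremented : ∀ b {t m} → t < (if b then m ∸ 1 else m) → t + indicator b < m
  below-decremented false {t}         t<m = subst (_< _) (sym (ℕ.+-identityʳ t)) t<m
  below-decremented true  {t} {suc m} t<m = subst (_< suc m) (ℕ.+-comm 1 t) (s≤s t<m)

  module VertexDeletion {alive E} (x : Fin n) (ax : alive x ≡ true) {L} (rep : Represents alive E L) where

    I N : List Edge
    I = filter (incident? x) L
    N = filter (¬? ∘ incident? x) L

    L↭I++N : L ↭ I ++ N
    L↭I++N = ↭-filter-split (incident? x) L

    links-split : ∀ u v → links u v L ≡ links u v I + links u v N
    links-split u v = trans (links-↭ u v L↭I++N) (links-++ u v I N)

    links-N-incident : ∀ {u v} → Incident x (u , v) → links u v N ≡ 0
    links-N-incident inc = links-filter-reject (¬? ∘ incident? x) L (λ ¬i → ¬i inc) (λ ¬i → ¬i (⊎-swap inc))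

    links-I-apart : ∀ {u v} → ¬ Incident x (u , v) → links u v I ≡ 0
    links-I-apart ¬inc = links-filter-reject (incident? x) L ¬inc (¬inc ∘ ⊎-swap)

    links-I : ∀ v → links x v I ≡ indicator (alive v ∧ E x v)
    links-I v = begin
      links x v I                ≡⟨ ℕ.+-identityʳ _ ⟨
      links x v I + 0            ≡⟨ cong (links x v I +_) (links-N-incident (inj₁ refl)) ⟨
      links x v I + links x v N  ≡⟨ links-split x v ⟨
      links x v L                ≡⟨ counts rep x v ⟩
      indicator (alive x ∧ alive v ∧ E x v) ≡⟨ cong (λ a → indicator (a ∧ alive v ∧ E x v)) ax ⟩
      indicator (alive v ∧ E x v) ∎
      where open ≡-Reasoning

    represents-N : Represents (kill alive x) E N
    represents-N = represents count′
      where
      count′ : ∀ u v → links u v N ≡ indicator (kill alive x u ∧ kill alive x v ∧ E u v)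
      count′ u v with incident? x (u , v)
      ... | yes inc@(inj₁ refl) = trans (links-N-incident inc)
        (sym (cong (λ b → indicator (b ∧ kill alive x v ∧ E u v)) (kill-self alive x)))
      ... | yes inc@(inj₂ refl) = trans (links-N-incident inc)
        (sym (trans (cong (λ b → indicator (kill alive x u ∧ b ∧ E u v)) (kill-self alive x)) (cong indicator (∧-zeroʳ (kill alive x u)))))
      ... | no ¬inc = begin
        links u v N                ≡⟨ cong (_+ links u v N) (links-I-apart ¬inc) ⟨
        links u v I + links u v N  ≡⟨ links-split u v ⟨
        links u v L                ≡⟨ counts rep u v ⟩
        indicator (alive u ∧ alive v ∧ E u v)
          ≡⟨ cong₂ (λ a b → indicator (a ∧ b ∧ E u v))
                   (kill-other alive (¬inc ∘ inj₁ ∘ sym)) (kill-other alive (¬inc ∘ inj₂ ∘ sym)) ⟨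
        indicator (kill alive x u ∧ kill alive x v ∧ E u v) ∎
        where open ≡-Reasoning

    leaving-I : All (Leaving x) I
    leaving-I = All.zipWith (uncurry incident⇒leaving)
      (all-filter (incident? x) L , All-filter⁺ (incident? x) (multiplicity≡0⇒All≢ (x , x) L (represents-loopless rep x)))

    raised : Exponent → Exponent
    raised t v = t v + links x v I

    admissible-raised : ∀ {f t} → 0 < f x → Admissible (kill alive x) (λ v → if alive v ∧ E x v then f v ∸ 1 else f v) t →
                        Admissible alive f (raised t)
    admissible-raised {f} {t} fx>0 adm = record { below = λ v → below′ (x ≟ v) ; vanish = vanish′ }
      where
      below′ : ∀ {v} → Dec (x ≡ v) → alive v ≡ true → raised t v < f v
      below′ (yes refl) _ =
        subst (_< f x) (sym (cong₂ _+_ (vanish adm x (kill-self alive x)) (links-leaving-self I leaving-I))) fx>0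
      below′ {v} (no x≢v) av = subst (_< f v) (cong (t v +_) (sym (links-I v)))
        (below-decremented (alive v ∧ E x v) (below adm v (trans (kill-other alive x≢v) av)))
      vanish′ : ∀ v → alive v ≡ false → raised t v ≡ 0
      vanish′ v dv = cong₂ _+_ (vanish adm v (trans (kill-other alive x≢v) dv))
                               (trans (links-I v) (cong (λ a → indicator (a ∧ E x v)) dv))
        where
        x≢v : x ≢ v
        x≢v refl with () ← trans (sym ax) dv

  vertexDelete-AT : ∀ {alive E f x} → alive x ≡ true → 0 < f x →
    (∀ N → Represents (kill alive x) E N → ATWitness (kill alive x) (λ v → if alive v ∧ E x v then f v ∸ 1 else f v) N) →
    ∀ L → Represents alive E L → ATWitness alive f L
  vertexDelete-AT {alive} {E} {f} {x} ax fx>0 IH L rep = extend (IH N represents-N)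
    where
    open VertexDeletion x ax rep
    extend : ATWitness (kill alive x) (λ v → if alive v ∧ E x v then f v ∸ 1 else f v) N → ATWitness alive f L
    extend (t , adm , nz) = raised t , admissible-raised fx>0 adm ,
      lift-vertex N I t leaving-I (vanish adm x (kill-self alive x)) nz ∘ trans (sym (factorCoeff-↭ L↭I++N (raised t)))

  weakStar⇒AT : ∀ {alive E f} → WDStar alive E f → ∀ L → Represents alive E L → ATWitness alive f L
  weakStar⇒AT (done dead) L rep = done-AT dead rep
  weakStar⇒AT {f = f} (reduceValue x s _ _ _ w) L rep with t , adm , nz ← weakStar⇒AT w L rep =
    t , admissible-weaken (update-decrease f x s) adm , nz
  weakStar⇒AT (edgeDelete x y ax ay exy fy<fx w) = edgeDelete-AT ax ay exy fy<fx (weakStar⇒AT w)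
  weakStar⇒AT (vertexDelete x ax fx>0 w)         = vertexDelete-AT ax fx>0 (weakStar⇒AT w)

  multiplicity-concat-tabulate-0 : ∀ {m} (F : Fin m → List Edge) e → (∀ a → multiplicity e (F a) ≡ 0) →
                                   multiplicity e (concat (List.tabulate F)) ≡ 0
  multiplicity-concat-tabulate-0 {zero}  F e none = refl
  multiplicity-concat-tabulate-0 {suc m} F e none =
    trans (multiplicity-++ e (F fzero) _) (cong₂ _+_ (none fzero) (multiplicity-concat-tabulate-0 (F ∘ fsuc) e (none ∘ fsuc)))

  multiplicity-concat-tabulate : ∀ {m} (F : Fin m → List Edge) e w → (∀ a → a ≢ w → multiplicity e (F a) ≡ 0) →
                                 multiplicity e (concat (List.tabulate F)) ≡ multiplicity e (F w)
  multiplicity-concat-tabulate {suc m} F e fzero others =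
    trans (multiplicity-++ e (F fzero) _)
          (trans (cong (multiplicity e (F fzero) +_) (multiplicity-concat-tabulate-0 (F ∘ fsuc) e (λ a → others (fsuc a) λ ())))
                 (ℕ.+-identityʳ _))
  multiplicity-concat-tabulate {suc m} F e (fsuc w) others =
    trans (multiplicity-++ e (F fzero) _)
          (cong₂ _+_ (others fzero λ ())
                     (multiplicity-concat-tabulate (F ∘ fsuc) e w (λ a a≢w → others (fsuc a) (a≢w ∘ Fin.suc-injective))))

  multiplicity-concatMap-allFin : ∀ {m} (F : Fin m → List Edge) e w → (∀ a → a ≢ w → multiplicity e (F a) ≡ 0) →
                                  multiplicity e (concatMap F (allFin m)) ≡ multiplicity e (F w)
  multiplicity-concatMap-allFin F e w others =
    trans (cong (multiplicity e ∘ concat) (List.map-tabulate (λ a → a) F)) (multiplicity-concat-tabulate F e w others)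

  multiplicity-if-here : ∀ c e → multiplicity e (if c then e ∷ [] else []) ≡ indicator c
  multiplicity-if-here false e = refl
  multiplicity-if-here true  e = multiplicity-here e []

  multiplicity-if-there : ∀ c {a e} → a ≢ e → multiplicity e (if c then a ∷ [] else []) ≡ 0
  multiplicity-if-there false a≢e = refl
  multiplicity-if-there true  a≢e = multiplicity-there _ [] a≢e

  multiplicity-edgePairs : ∀ (G : Graph n) u v → multiplicity (u , v) (edgePairs G) ≡ indicator (does (u <? v) ∧ adj G u v)
  multiplicity-edgePairs G u v =
    trans (multiplicity-concatMap-allFin row (u , v) u
            (λ a a≢u → trans (multiplicity-concatMap-allFin (cell a) (u , v) v (λ b _ → multiplicity-if-there (c a b) (a≢u ∘ cong proj₁)))
                             (multiplicity-if-there (c a v) (a≢u ∘ cong proj₁))))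
    (trans (multiplicity-concatMap-allFin (cell u) (u , v) v (λ b b≢v → multiplicity-if-there (c u b) (b≢v ∘ cong proj₂)))
           (multiplicity-if-here (c u v) (u , v)))
    where
    c : Fin n → Fin n → Bool
    c a b = does (a <? b) ∧ adj G a b
    cell : Fin n → Fin n → List Edge
    cell a b = if c a b then (a , b) ∷ [] else []
    row : Fin n → List Edge
    row a = concatMap (cell a) (allFin n)

  represents-edgePairs : ∀ (G : Graph n) → Represents (λ _ → true) (adj G) (edgePairs G)
  represents-edgePairs G = represents λ u v →
    trans (cong₂ _+_ (multiplicity-edgePairs G u v) (multiplicity-edgePairs G v u)) (byOrder u v (Fin.<-cmp u v))
    where
    byOrder : ∀ u v → _ → indicator (does (u <? v) ∧ adj G u v) + indicator (does (v <? u) ∧ adj G v u) ≡ indicator (adj G u v)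
    byOrder u v (tri< u<v _ v≮u) rewrite dec-true (u <? v) u<v | dec-false (v <? u) v≮u = ℕ.+-identityʳ _
    byOrder u v (tri> u≮v _ v<u) rewrite dec-false (u <? v) u≮v | dec-true (v <? u) v<u = cong indicator (Graph.sym G v u)
    byOrder u v (tri≈ u≮v refl _) rewrite dec-false (u <? u) u≮v | Graph.irrefl G u = refl

weakStar⇒IsAT : ∀ (n : ℕ) (G : Graph n) (f : Fin n → ℕ) → IsWeakStarDegenerate G f → IsAT G f
weakStar⇒IsAT n G f wd with t , adm , nz ← weakStar⇒AT wd (edgePairs G) (represents-edgePairs G) =
  t , (λ v → subst (_≤ f v) (ℕ.+-comm 1 (t v)) (Admissible.below adm v refl)) ,
  nz ∘ trans (sym (coeff-productFactors (edgePairs G) t))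

theorem2 : (∀ (n : ℕ) (G : Graph n) (f : Fin n → ℕ) → IsWeakStarDegenerate G f → IsAT G f)
         × (∀ (n : ℕ) (G : Graph n) (d : ℕ) → IsWeakStarDegenerate G (λ _ → d) → IsAT G (λ _ → d))
theorem2 = weakStar⇒IsAT , λ n G d → weakStar⇒IsAT n G (λ _ → d)
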